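{- Let $\ell$ be a prime and $n,N$ positive integers with $n^2\mid N$ and $\ell\nmid N$. Then for every $e\ge1$, \[ \#C_{N,n}(\ell^e)=\ell^{3(e-1)+1}\left(\ell^2-\ell-1-\left(\frac{N-1}{\ell}\right)^2\right). \]
   Context: $C_{N,n}(\ell^e)=\{\sigma\in\mathrm{GL}_2(\mathbb Z/\ell^e\mathbb Z):\det(\sigma)+1-\mathrm{tr}(\sigma)\equiv N\pmod{\ell^e},\ \sigma\equiv I\pmod{\ell^{\nu_\ell(n)}}\}$, with $I$ the identity matrix and $\nu_\ell$ the $\ell$-adic valuation. $\left(\frac{a}{\ell}\right)^2$ is $1$ if $\ell\nmid a$ and $0$ otherwise. -}

module Defs where

open import Data.Nat as ℕ using (ℕ; zero; suc; _^_)
import Data.Nat.Divisibility as ℕD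
open import Data.Integer as ℤ using (ℤ; +_; _-_; _*_; _+_)
open import Data.Integer.Divisibility using (_∣_)
open import Data.Fin using (Fin; toℕ)
open import Data.Product using (_×_; _,_; Σ; ∃)
open import Data.List using (List; allFin; cartesianProduct; filter; length)
open import Relation.Nullary using (Dec; yes; no; ¬_; does)
open import Relation.Nullary.Decidable using (_×-dec_; ¬?)
open import Data.Fin.Properties using (any?)
open import Data.Bool using (if_then_else_)

infix 4 _≡_[mod_] _≡?_[mod_]
_≡_[mod_] : ℤ → ℤ → ℕ → Set
a ≡ b [mod m ] = (+ m) ∣ (a - b)

_≡?_[mod_] : (a b : ℤ) (m : ℕ) → Dec (a ≡ b [mod m ])
a ≡? b [mod m ] = m ℕD.∣? ℤ.∣ a - b ∣

-- ℓ-adic valuation of n (for ℓ ≥ 2, n ≥ 1): the largest k ≤ n with ℓ^k ∣ n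
-- (for such ℓ, n every k with ℓ^k ∣ n satisfies k ≤ n, so this is ν_ℓ(n))
ν : ℕ → ℕ → ℕ
ν ℓ n = go n
  where
  go : ℕ → ℕ
  go zero = zero
  go (suc k) = if does ((ℓ ^ suc k) ℕD.∣? n) then suc k else go k

-- 2x2 matrices over ℤ/mℤ, entries represented by Fin m: (a , b , c , d) = [[a,b],[c,d]]
Mat₂ : ℕ → Set
Mat₂ m = Fin m × Fin m × Fin m × Fin m

allMat₂ : (m : ℕ) → List (Mat₂ m)
allMat₂ m = cartesianProduct (allFin m)
              (cartesianProduct (allFin m) (cartesianProduct (allFin m) (allFin m)))

ent : {m : ℕ} → Fin m → ℤ
ent x = + toℕ x

det : {m : ℕ} → Mat₂ m → ℤ
det (a , b , c , d) = ent a * ent d - ent b * ent c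

tr : {m : ℕ} → Mat₂ m → ℤ
tr (a , b , c , d) = ent a + ent d

InGL₂ : (m : ℕ) → Mat₂ m → Set
InGL₂ m σ = ∃ λ (x : Fin m) → det σ * ent x ≡ + 1 [mod m ]

InGL₂? : (m : ℕ) (σ : Mat₂ m) → Dec (InGL₂ m σ)
InGL₂? m σ = any? (λ x → (det σ * ent x) ≡? + 1 [mod m ])

CongI : {m : ℕ} → ℕ → Mat₂ m → Set
CongI k (a , b , c , d) =
  (ent a ≡ + 1 [mod k ]) × (ent b ≡ + 0 [mod k ]) × (ent c ≡ + 0 [mod k ]) × (ent d ≡ + 1 [mod k ])

CongI? : {m : ℕ} (k : ℕ) (σ : Mat₂ m) → Dec (CongI k σ)
CongI? k (a , b , c , d) =
  (ent a ≡? + 1 [mod k ]) ×-dec (ent b ≡? + 0 [mod k ]) ×-dec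
  (ent c ≡? + 0 [mod k ]) ×-dec (ent d ≡? + 1 [mod k ])

InC : (N n ℓ e : ℕ) → Mat₂ (ℓ ^ e) → Set
InC N n ℓ e σ =
  InGL₂ (ℓ ^ e) σ × ((det σ + + 1 - tr σ) ≡ + N [mod ℓ ^ e ]) × CongI (ℓ ^ ν ℓ n) σ

InC? : (N n ℓ e : ℕ) (σ : Mat₂ (ℓ ^ e)) → Dec (InC N n ℓ e σ)
InC? N n ℓ e σ =
  InGL₂? (ℓ ^ e) σ ×-dec ((det σ + + 1 - tr σ) ≡? + N [mod ℓ ^ e ]) ×-dec CongI? (ℓ ^ ν ℓ n) σ

#C : (N n ℓ e : ℕ) → ℕ
#C N n ℓ e = length (filter (InC? N n ℓ e) (allMat₂ (ℓ ^ e)))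

legendreSq : ℤ → ℕ → ℤ
legendreSq a ℓ = if does (ℓ ℕD.∣? ℤ.∣ a ∣) then + 0 else + 1

{-# OPTIONS --safe #-}
module Submission where

-- Since n² ∣ N and ℓ ∤ N, also ℓ ∤ n, so σ ≡ I (mod ℓ^ν(n)) is no condition and C consists of the
-- σ = [[a,b],[c,d]] modulo m = ℓ^e with Δ := det σ + 1 − tr σ − N ≡ 0 (mod m) and ℓ ∤ det σ; as
-- det σ ≡ a + d + N − 1 there, the unit condition only involves a and d.  Δ is linear in each
-- entry, and a unit coefficient leaves exactly one solution: if ℓ ∤ c, one b; if ℓ ∣ c but ℓ ∤ b,
-- one c, which is ≡ 0 (mod ℓ) exactly when (a − 1)(d − 1) ≡ N (mod ℓ); if ℓ divides b and c, one d,
-- provided ℓ ∤ a − 1.  In the last two cases (a − 1)(d − 1) ≡ N forces ℓ ∤ a − 1 and turns the unit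
-- condition into ℓ ∤ a(a + N − 1), so a has to avoid the residues 1, 0 and 1 − N, which leaves
-- ℓ − 3 + [ℓ ∣ N − 1] classes mod ℓ.  With p = ℓ^(e−1) and φ = m − p units this gives
-- #C = m φ² + φ p² q + p³ q = m φ² + m p² q, where q = ℓ − 3 + [ℓ ∣ N − 1].

open import Defs
open import Data.Bool.Base using (if_then_else_)
open import Data.Fin.Base using (Fin; toℕ; fromℕ<) renaming (zero to fzero; suc to fsuc)
open import Data.Fin.Properties using (toℕ-fromℕ<)
open import Data.List.Base using (List; []; _∷_; _++_; map; length; filter; cartesianProduct; allFin; tabulate)
open import Data.List.Properties using (map-++; map-∘)
open import Data.Nat.ListAction using (sum)
open import Data.Nat.ListAction.Properties using (sum-++)
open import Data.Nat.Base
open import Data.Nat.Properties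
open import Data.Nat.Divisibility using (_∣_; _∣?_; ∣-trans; m∣m*n; 1∣_; ∣1⇒≡1; >⇒∤)
open import Data.Nat.Primality using (Prime; ¬prime[1]; prime⇒irreducible; prime⇒nonZero; euclidsLemma)
open import Data.Nat.Coprimality using (Coprime; coprime-Bézout)
open import Data.Nat.GCD using (module Bézout)
open import Data.Integer.Base as ℤ using (ℤ; +_; ∣_∣)
  renaming (_+_ to _+ᶻ_; _-_ to _-ᶻ_; _*_ to _*ᶻ_; -_ to -ᶻ_)
import Data.Integer.Properties as ℤ
open import Data.Integer.DivMod using (_%ℕ_; _/ℕ_; n%ℕd<d; a≡a%ℕn+[a/ℕn]*n)
open import Data.Integer.Divisibility.Signed
  using (∣ᵤ⇒∣; ∣⇒∣ᵤ; ∣m∣n⇒∣m+n; ∣n⇒∣m*n; ∣m⇒∣m*n; ∣m∣n⇒∣m-n; *-monoˡ-∣; *-monoʳ-∣)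
  renaming (_∣_ to _∣ᶻ_; divides to dividesᶻ; ∣-trans to ∣ᶻ-trans)
open import Data.Integer.Tactic.RingSolver using (solve-∀)
import Data.Nat.Tactic.RingSolver as ℕ-Solver
open import Data.Product.Base using (_×_; _,_; proj₁; proj₂; ∃-syntax)
open import Data.Sum.Base using (_⊎_; inj₁; inj₂)
open import Function.Base using (_∘_)
open import Relation.Nullary using (Dec; yes; no; ¬_; does; contradiction; contraposition)
open import Relation.Nullary.Decidable using (_×-dec_; ¬?)
open import Relation.Binary.PropositionalEquality
  using (_≡_; refl; sym; trans; cong; cong₂; subst; module ≡-Reasoning)
open import Algebra.Properties.CommutativeSemigroup +-commutativeSemigroup
  using () renaming (interchange to +-interchange)

private
  variable
    P Q : Set

-- Indicators and finite sums

𝟙 : Dec P → ℕ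
𝟙 (yes _) = 1
𝟙 (no _)  = 0

𝟙-yes : (P? : Dec P) → P → 𝟙 P? ≡ 1
𝟙-yes (yes _) _ = refl
𝟙-yes (no ¬p) p = contradiction p ¬p

𝟙-no : (P? : Dec P) → ¬ P → 𝟙 P? ≡ 0
𝟙-no (yes p) ¬p = contradiction p ¬p
𝟙-no (no _)  _  = refl

𝟙-cong : (P? : Dec P) (Q? : Dec Q) → (P → Q) → (Q → P) → 𝟙 P? ≡ 𝟙 Q?
𝟙-cong (yes p) Q? f g = sym (𝟙-yes Q? (f p))
𝟙-cong (no ¬p) Q? f g = sym (𝟙-no Q? (contraposition g ¬p))

𝟙-¬-cong : (P? : Dec P) (Q? : Dec Q) → 𝟙 P? ≡ 𝟙 Q? → 𝟙 (¬? P?) ≡ 𝟙 (¬? Q?)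
𝟙-¬-cong (yes _) (yes _) _ = refl
𝟙-¬-cong (no _)  (no _)  _ = refl

𝟙-× : (P? : Dec P) (Q? : Dec Q) → 𝟙 (P? ×-dec Q?) ≡ 𝟙 P? * 𝟙 Q?
𝟙-× (yes _) (yes _) = refl
𝟙-× (yes _) (no _)  = refl
𝟙-× (no _)  _       = refl

𝟙-¬+𝟙 : (P? : Dec P) → 𝟙 (¬? P?) + 𝟙 P? ≡ 1
𝟙-¬+𝟙 (yes _) = refl
𝟙-¬+𝟙 (no _)  = refl

𝟙-*-cong : ∀ {x y} (P? : Dec P) → (P → x ≡ y) → 𝟙 P? * x ≡ 𝟙 P? * y
𝟙-*-cong (yes p) x≡y = cong (1 *_) (x≡y p)
𝟙-*-cong (no _)  _   = refl

∑ : ℕ → (ℕ → ℕ) → ℕ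
∑ zero    f = 0
∑ (suc n) f = f 0 + ∑ n (f ∘ suc)

syntax ∑ n (λ i → f) = ∑[ i < n ] f

∑-cong-< : ∀ n {f g : ℕ → ℕ} → (∀ i → i < n → f i ≡ g i) → ∑ n f ≡ ∑ n g
∑-cong-< zero    eq = refl
∑-cong-< (suc n) eq = cong₂ _+_ (eq 0 z<s) (∑-cong-< n (λ i i<n → eq (suc i) (s<s i<n)))

∑-cong : ∀ n {f g : ℕ → ℕ} → (∀ i → f i ≡ g i) → ∑ n f ≡ ∑ n g
∑-cong n eq = ∑-cong-< n (λ i _ → eq i)

∑-distrib-+ : ∀ n (f g : ℕ → ℕ) → ∑[ i < n ] (f i + g i) ≡ ∑ n f + ∑ n g
∑-distrib-+ zero    f g = refl
∑-distrib-+ (suc n) f g = trans (cong (_+_ (f 0 + g 0)) (∑-distrib-+ n (f ∘ suc) (g ∘ suc)))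
  (+-interchange (f 0) (g 0) _ _)

∑-*ˡ : ∀ n k (f : ℕ → ℕ) → ∑[ i < n ] (k * f i) ≡ k * ∑ n f
∑-*ˡ zero    k f = sym (*-zeroʳ k)
∑-*ˡ (suc n) k f = trans (cong (_+_ (k * f 0)) (∑-*ˡ n k (f ∘ suc))) (sym (*-distribˡ-+ k (f 0) _))

∑-*ʳ : ∀ n k (f : ℕ → ℕ) → ∑[ i < n ] (f i * k) ≡ ∑ n f * k
∑-*ʳ n k f = trans (∑-cong n (λ i → *-comm (f i) k)) (trans (∑-*ˡ n k f) (*-comm k _))

∑-const : ∀ n k → ∑[ i < n ] k ≡ n * k
∑-const zero    k = refl
∑-const (suc n) k = cong (_+_ k) (∑-const n k)

∑-zero : ∀ n (f : ℕ → ℕ) → (∀ i → i < n → f i ≡ 0) → ∑ n f ≡ 0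
∑-zero n f eq = trans (∑-cong-< n eq) (trans (∑-const n 0) (*-zeroʳ n))

∑-comm : ∀ n k (f : ℕ → ℕ → ℕ) → ∑[ i < n ] ∑[ j < k ] f i j ≡ ∑[ j < k ] ∑[ i < n ] f i j
∑-comm zero    k f = sym (∑-zero k (λ _ → 0) (λ _ _ → refl))
∑-comm (suc n) k f = trans (cong (_+_ (∑ k (f 0))) (∑-comm n k (f ∘ suc)))
  (sym (∑-distrib-+ k (f 0) (λ j → ∑[ i < n ] f (suc i) j)))

∑-split : ∀ n k (f : ℕ → ℕ) → ∑ (n + k) f ≡ ∑ n f + ∑[ i < k ] f (n + i)
∑-split zero    k f = refl
∑-split (suc n) k f = trans (cong (_+_ (f 0)) (∑-split n k (f ∘ suc))) (sym (+-assoc (f 0) _ _))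

∑-periodic : ∀ k q (f : ℕ → ℕ) → (∀ i → f (k + i) ≡ f i) → ∑ (q * k) f ≡ q * ∑ k f
∑-periodic k zero    f per = refl
∑-periodic k (suc q) f per = trans (∑-split k (q * k) f)
  (cong (_+_ (∑ k f)) (trans (∑-cong (q * k) per) (∑-periodic k q f per)))

∑-𝟙-unique : ∀ n {P : ℕ → Set} (P? : ∀ i → Dec (P i)) i₀ → i₀ < n → P i₀ →
  (∀ i → i < n → P i → i ≡ i₀) → ∑[ i < n ] 𝟙 (P? i) ≡ 1
∑-𝟙-unique (suc n) P? zero _ p₀ unique =
  cong₂ _+_ (𝟙-yes (P? 0) p₀)
    (∑-zero n _ (λ i i<n → 𝟙-no (P? (suc i)) (λ p → 1+n≢0 (unique (suc i) (s<s i<n) p))))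
∑-𝟙-unique (suc n) P? (suc i₀) (s<s i₀<n) p₀ unique =
  cong₂ _+_ (𝟙-no (P? 0) (λ p → 1+n≢0 (sym (unique 0 z<s p))))
    (∑-𝟙-unique n (P? ∘ suc) i₀ i₀<n p₀ (λ i i<n p → suc-injective (unique (suc i) (s<s i<n) p)))

length-filter : {A : Set} {P : A → Set} (P? : ∀ x → Dec (P x)) (xs : List A) →
  length (filter P? xs) ≡ sum (map (𝟙 ∘ P?) xs)
length-filter P? [] = refl
length-filter P? (x ∷ xs) with P? x
... | yes _ = cong suc (length-filter P? xs)
... | no _  = length-filter P? xs

sum-cartesianProduct : {A B : Set} (f : A × B → ℕ) (xs : List A) (ys : List B) →
  sum (map f (cartesianProduct xs ys)) ≡ sum (map (λ x → sum (map (λ y → f (x , y)) ys)) xs)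
sum-cartesianProduct f [] ys = refl
sum-cartesianProduct f (x ∷ xs) ys = begin
  sum (map f (map (x ,_) ys ++ cartesianProduct xs ys))
    ≡⟨ cong sum (map-++ f (map (x ,_) ys) (cartesianProduct xs ys)) ⟩
  sum (map f (map (x ,_) ys) ++ map f (cartesianProduct xs ys))
    ≡⟨ sum-++ (map f (map (x ,_) ys)) _ ⟩
  sum (map f (map (x ,_) ys)) + sum (map f (cartesianProduct xs ys))
    ≡⟨ cong₂ _+_ (cong sum (sym (map-∘ ys))) (sum-cartesianProduct f xs ys) ⟩
  sum (map (λ y → f (x , y)) ys) + sum (map (λ x → sum (map (λ y → f (x , y)) ys)) xs) ∎
  where open ≡-Reasoning

sum-tabulate : ∀ n {A : Set} (t : Fin n → A) (f : A → ℕ) (g : ℕ → ℕ) →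
  (∀ x → f (t x) ≡ g (toℕ x)) → sum (map f (tabulate t)) ≡ ∑ n g
sum-tabulate zero    t f g eq = refl
sum-tabulate (suc n) t f g eq =
  cong₂ _+_ (eq fzero) (sum-tabulate n (t ∘ fsuc) f (g ∘ suc) (eq ∘ fsuc))

sum-allFin : ∀ n (f : Fin n → ℕ) (g : ℕ → ℕ) → (∀ x → f x ≡ g (toℕ x)) →
  sum (map f (allFin n)) ≡ ∑ n g
sum-allFin n = sum-tabulate n (λ x → x)

sum-allMat₂ : ∀ m (f : Mat₂ m → ℕ) (g : ℕ → ℕ → ℕ → ℕ → ℕ) →
  (∀ a b c d → f (a , b , c , d) ≡ g (toℕ a) (toℕ b) (toℕ c) (toℕ d)) →
  sum (map f (allMat₂ m)) ≡ ∑[ a < m ] ∑[ b < m ] ∑[ c < m ] ∑[ d < m ] g a b c d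
sum-allMat₂ m f g eq =
  trans (sum-cartesianProduct f (allFin m) _) (sum-allFin m _ _ λ a →
  trans (sum-cartesianProduct _ (allFin m) _) (sum-allFin m _ _ λ b →
  trans (sum-cartesianProduct _ (allFin m) _) (sum-allFin m _ _ λ c →
  sum-allFin m _ _ λ d → eq a b c d)))

-- Divisibility and inverses modulo prime powers

∣-multiple : ∀ {k x z} (a : ℤ) → k ∣ᶻ x → z ≡ a *ᶻ x → k ∣ᶻ z
∣-multiple a k∣x eq = subst (_ ∣ᶻ_) (sym eq) (∣n⇒∣m*n a k∣x)

∣-lincomb : ∀ {k x y z} (a b : ℤ) → k ∣ᶻ x → k ∣ᶻ y → z ≡ a *ᶻ x +ᶻ b *ᶻ y → k ∣ᶻ z
∣-lincomb a b k∣x k∣y eq = subst (_ ∣ᶻ_) (sym eq) (∣m∣n⇒∣m+n (∣n⇒∣m*n a k∣x) (∣n⇒∣m*n b k∣y))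

∣-diffˡ : ∀ {k x y} → k ∣ᶻ x -ᶻ y → k ∣ᶻ y → k ∣ᶻ x
∣-diffˡ {x = x} {y} k∣x-y k∣y = ∣-lincomb (+ 1) (+ 1) k∣x-y k∣y (identity x y)
  where
  identity : ∀ x y → x ≡ + 1 *ᶻ (x -ᶻ y) +ᶻ + 1 *ᶻ y
  identity = solve-∀

∣-diffʳ : ∀ {k x y} → k ∣ᶻ x -ᶻ y → k ∣ᶻ x → k ∣ᶻ y
∣-diffʳ {x = x} {y} k∣x-y k∣x = ∣-lincomb (-ᶻ + 1) (+ 1) k∣x-y k∣x (identity x y)
  where
  identity : ∀ x y → y ≡ (-ᶻ + 1) *ᶻ (x -ᶻ y) +ᶻ + 1 *ᶻ x
  identity = solve-∀

∣-%ℕ : ∀ z K .{{_ : NonZero K}} → + K ∣ᶻ z -ᶻ + (z %ℕ K)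
∣-%ℕ z K = dividesᶻ (z /ℕ K) (trans (cong (_-ᶻ + (z %ℕ K)) (a≡a%ℕn+[a/ℕn]*n z K)) (identity (+ (z %ℕ K)) _))
  where
  identity : ∀ r q → r +ᶻ q -ᶻ r ≡ q
  identity = solve-∀

∣+m-+n∣≡∣m-n∣ : ∀ m n → ∣ + m -ᶻ + n ∣ ≡ ∣ m - n ∣
∣+m-+n∣≡∣m-n∣ zero    zero    = refl
∣+m-+n∣≡∣m-n∣ zero    (suc n) = refl
∣+m-+n∣≡∣m-n∣ (suc m) zero    = cong suc (+-identityʳ m)
∣+m-+n∣≡∣m-n∣ (suc m) (suc n) =
  trans (cong ∣_∣ (trans (ℤ.m-n≡m⊖n (suc m) (suc n))
    (trans (ℤ.[1+m]⊖[1+n]≡m⊖n m n) (sym (ℤ.m-n≡m⊖n m n))))) (∣+m-+n∣≡∣m-n∣ m n)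

∣-<⇒≡ : ∀ {K m n} → m < K → n < K → + K ∣ᶻ + m -ᶻ + n → m ≡ n
∣-<⇒≡ {K} {m} {n} m<K n<K K∣m-n with ∣ m - n ∣ in eq
... | zero  = ∣m-n∣≡0⇒m≡n eq
... | suc t = contradiction (subst (K ∣_) (trans (∣+m-+n∣≡∣m-n∣ m n) eq) (∣⇒∣ᵤ K∣m-n)) (>⇒∤ t<K)
  where
  t<K : suc t < K
  t<K = subst (_< K) eq (≤-<-trans (∣m-n∣≤m⊔n m n) (⊔-lub m<K n<K))

[_∣_] : ℕ → ℤ → ℕ
[ k ∣ x ] = 𝟙 (k ∣? ∣ x ∣)

[_∤_] : ℕ → ℤ → ℕ
[ k ∤ x ] = 𝟙 (¬? (k ∣? ∣ x ∣))

[∣]-cong : ∀ {k} x y → + k ∣ᶻ x -ᶻ y → [ k ∣ x ] ≡ [ k ∣ y ]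
[∣]-cong {k} x y k∣x-y = 𝟙-cong (k ∣? ∣ x ∣) (k ∣? ∣ y ∣)
  (λ k∣x → ∣⇒∣ᵤ (∣-diffʳ {x = x} k∣x-y (∣ᵤ⇒∣ k∣x)))
  (λ k∣y → ∣⇒∣ᵤ (∣-diffˡ {x = x} k∣x-y (∣ᵤ⇒∣ k∣y)))

[∤]-cong : ∀ {k} x y → + k ∣ᶻ x -ᶻ y → [ k ∤ x ] ≡ [ k ∤ y ]
[∤]-cong {k} x y k∣x-y = 𝟙-¬-cong (k ∣? ∣ x ∣) (k ∣? ∣ y ∣) ([∣]-cong x y k∣x-y)

[∣]-neg : ∀ k {x y} → x ≡ -ᶻ y → [ k ∣ x ] ≡ [ k ∣ y ]
[∣]-neg k {y = y} x≡-y = cong (𝟙 ∘ (k ∣?_)) (trans (cong ∣_∣ x≡-y) (ℤ.∣-i∣≡∣i∣ y))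

Invertible : ℕ → ℤ → Set
Invertible K u = ∃[ v ] + K ∣ᶻ u *ᶻ v -ᶻ + 1

module _ {ℓ : ℕ} (ℓ-prime : Prime ℓ) where

  prime∤1 : ¬ (+ ℓ ∣ᶻ + 1)
  prime∤1 ℓ∣1 = ¬prime[1] (subst Prime (∣1⇒≡1 (∣⇒∣ᵤ ℓ∣1)) ℓ-prime)

  euclidsLemmaᶻ : ∀ x y → + ℓ ∣ᶻ x *ᶻ y → + ℓ ∣ᶻ x ⊎ + ℓ ∣ᶻ y
  euclidsLemmaᶻ x y ℓ∣xy
    with euclidsLemma ∣ x ∣ ∣ y ∣ ℓ-prime (subst (ℓ ∣_) (ℤ.abs-* x y) (∣⇒∣ᵤ ℓ∣xy))
  ... | inj₁ ℓ∣x = inj₁ (∣ᵤ⇒∣ ℓ∣x)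
  ... | inj₂ ℓ∣y = inj₂ (∣ᵤ⇒∣ ℓ∣y)

  invertible-mod-prime : ∀ {u} → ¬ ℓ ∣ ∣ u ∣ → Invertible ℓ u
  invertible-mod-prime {u} ℓ∤u = fix-sign (inverse (coprime-Bézout ℓ⊥w)) (ℤ.+∣i∣≡i⊎+∣i∣≡-i u)
    where
    w = ∣ u ∣
    ℓ⊥w : Coprime ℓ w
    ℓ⊥w (d∣ℓ , d∣w) with prime⇒irreducible ℓ-prime d∣ℓ
    ... | inj₁ d≡1 = d≡1
    ... | inj₂ refl = contradiction d∣w ℓ∤u
    cast : ∀ x y z t → 1 + x * y ≡ z * t → + 1 +ᶻ + x *ᶻ + y ≡ + z *ᶻ + t
    cast x y z t eq = trans (cong (+ 1 +ᶻ_) (sym (ℤ.pos-* x y)))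
      (trans (cong +_ eq) (ℤ.pos-* z t))
    inverse : Bézout.Identity 1 ℓ w → Invertible ℓ (+ w)
    inverse (Bézout.-+ x y eq) = + y , dividesᶻ (+ x) (identity (+ w) (+ x) (+ y) (+ ℓ) (cast x ℓ y w eq))
      where
      identity : ∀ w x y ℓ → + 1 +ᶻ x *ᶻ ℓ ≡ y *ᶻ w → w *ᶻ y -ᶻ + 1 ≡ x *ᶻ ℓ
      identity w x y ℓ eq = trans (cong (_-ᶻ + 1) (ℤ.*-comm w y))
        (trans (cong (_-ᶻ + 1) (sym eq)) (cancel x ℓ))
        where
        cancel : ∀ x ℓ → + 1 +ᶻ x *ᶻ ℓ -ᶻ + 1 ≡ x *ᶻ ℓ
        cancel = solve-∀
    inverse (Bézout.+- x y eq) =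
      -ᶻ + y , dividesᶻ (-ᶻ + x) (identity (+ w) (+ x) (+ y) (+ ℓ) (cast y w x ℓ eq))
      where
      identity : ∀ w x y ℓ → + 1 +ᶻ y *ᶻ w ≡ x *ᶻ ℓ → w *ᶻ (-ᶻ y) -ᶻ + 1 ≡ (-ᶻ x) *ᶻ ℓ
      identity w x y ℓ eq = trans (negate w y) (trans (cong -ᶻ_ eq) (ℤ.neg-distribˡ-* x ℓ))
        where
        negate : ∀ w y → w *ᶻ (-ᶻ y) -ᶻ + 1 ≡ -ᶻ (+ 1 +ᶻ y *ᶻ w)
        negate = solve-∀
    fix-sign : Invertible ℓ (+ w) → + w ≡ u ⊎ + w ≡ -ᶻ u → Invertible ℓ u
    fix-sign (v , ℓ∣wv-1) (inj₁ w≡u)  = v , subst (λ t → + ℓ ∣ᶻ t *ᶻ v -ᶻ + 1) w≡u ℓ∣wv-1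
    fix-sign (v , ℓ∣wv-1) (inj₂ w≡-u) =
      -ᶻ v , subst (+ ℓ ∣ᶻ_) (negate u v) (subst (λ t → + ℓ ∣ᶻ t *ᶻ v -ᶻ + 1) w≡-u ℓ∣wv-1)
      where
      negate : ∀ u v → (-ᶻ u) *ᶻ v -ᶻ + 1 ≡ u *ᶻ (-ᶻ v) -ᶻ + 1
      negate = solve-∀

  invertible-mod-prime^ : ∀ {u} → ¬ ℓ ∣ ∣ u ∣ → ∀ k → Invertible (ℓ ^ k) u
  invertible-mod-prime^ ℓ∤u zero = + 0 , ∣ᵤ⇒∣ (1∣ _)
  invertible-mod-prime^ {u} ℓ∤u (suc k)
    with invertible-mod-prime {u} ℓ∤u | invertible-mod-prime^ {u} ℓ∤u k
  ... | v , ℓ∣uv-1 | w , ℓᵏ∣uw-1 =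
    w +ᶻ v -ᶻ u *ᶻ w *ᶻ v , ∣-multiple (-ᶻ + 1) ℓᵏ⁺¹∣product (newton u v w)
    where
    ℓᵏ⁺¹∣product : + (ℓ * ℓ ^ k) ∣ᶻ (u *ᶻ v -ᶻ + 1) *ᶻ (u *ᶻ w -ᶻ + 1)
    ℓᵏ⁺¹∣product = subst (_∣ᶻ (u *ᶻ v -ᶻ + 1) *ᶻ (u *ᶻ w -ᶻ + 1)) (sym (ℤ.pos-* ℓ (ℓ ^ k)))
      (∣ᶻ-trans (*-monoˡ-∣ (+ (ℓ ^ k)) ℓ∣uv-1) (*-monoʳ-∣ (u *ᶻ v -ᶻ + 1) ℓᵏ∣uw-1))
    -- Hensel lifting: the error u·v′ − 1 of the new inverse is minus the product of the old errors.
    newton : ∀ u v w → u *ᶻ (w +ᶻ v -ᶻ u *ᶻ w *ᶻ v) -ᶻ + 1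
                       ≡ (-ᶻ + 1) *ᶻ ((u *ᶻ v -ᶻ + 1) *ᶻ (u *ᶻ w -ᶻ + 1))
    newton = solve-∀

-- Linear congruences

linear-congruence-count₁ : ∀ K .{{_ : NonZero K}} (u s : ℤ) → Invertible K u →
  ∑[ x < K ] [ K ∣ u *ᶻ + x -ᶻ s ] ≡ 1
linear-congruence-count₁ K u s (v , K∣uv-1) =
  ∑-𝟙-unique K (λ x → K ∣? ∣ u *ᶻ + x -ᶻ s ∣) x₀ x₀<K (∣⇒∣ᵤ x₀-solves) unique
  where
  x₀ = (v *ᶻ s) %ℕ K
  x₀<K = n%ℕd<d (v *ᶻ s) K
  x₀-solves : + K ∣ᶻ u *ᶻ + x₀ -ᶻ s
  x₀-solves = ∣-lincomb s (-ᶻ u) K∣uv-1 (∣-%ℕ (v *ᶻ s) K) (identity u v s (+ x₀))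
    where
    identity : ∀ u v s x → u *ᶻ x -ᶻ s ≡ s *ᶻ (u *ᶻ v -ᶻ + 1) +ᶻ (-ᶻ u) *ᶻ (v *ᶻ s -ᶻ x)
    identity = solve-∀
  unique : ∀ x → x < K → K ∣ ∣ u *ᶻ + x -ᶻ s ∣ → x ≡ x₀
  unique x x<K K∣ux-s = ∣-<⇒≡ x<K x₀<K
    (∣-lincomb v (-ᶻ (+ x -ᶻ + x₀)) (∣m∣n⇒∣m-n {m = u *ᶻ + x -ᶻ s} (∣ᵤ⇒∣ K∣ux-s) x₀-solves) K∣uv-1
      (identity u v s (+ x) (+ x₀)))
    where
    identity : ∀ u v s x y →
      x -ᶻ y ≡ v *ᶻ ((u *ᶻ x -ᶻ s) -ᶻ (u *ᶻ y -ᶻ s)) +ᶻ (-ᶻ (x -ᶻ y)) *ᶻ (u *ᶻ v -ᶻ + 1)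
    identity = solve-∀

linear-congruence-count : ∀ K .{{_ : NonZero K}} q (u s : ℤ) → Invertible K u →
  ∑[ x < q * K ] [ K ∣ u *ᶻ + x -ᶻ s ] ≡ q
linear-congruence-count K q u s u-inv =
  trans (∑-periodic K q _ periodic) (trans (cong (q *_) (linear-congruence-count₁ K u s u-inv)) (*-identityʳ q))
  where
  periodic : ∀ x → [ K ∣ u *ᶻ + (K + x) -ᶻ s ] ≡ [ K ∣ u *ᶻ + x -ᶻ s ]
  periodic x = [∣]-cong (u *ᶻ + (K + x) -ᶻ s) (u *ᶻ + x -ᶻ s) (dividesᶻ u
    (trans (cong (λ t → (u *ᶻ t -ᶻ s) -ᶻ (u *ᶻ + x -ᶻ s)) (ℤ.pos-+ K x))
    (identity u s (+ K) (+ x))))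
    where
    identity : ∀ u s K x → (u *ᶻ (K +ᶻ x) -ᶻ s) -ᶻ (u *ᶻ x -ᶻ s) ≡ u *ᶻ K
    identity = solve-∀

residue-count : ∀ K .{{_ : NonZero K}} q t → ∑[ x < q * K ] [ K ∣ + x -ᶻ t ] ≡ q
residue-count K q t =
  trans (∑-cong (q * K) (λ x → cong (λ y → [ K ∣ y -ᶻ t ]) (sym (ℤ.*-identityˡ (+ x)))))
    (linear-congruence-count K q (+ 1) t (+ 1 , dividesᶻ (+ 0) refl))

nonresidue-count : ∀ K .{{_ : NonZero K}} q t → ∑[ x < q * K ] [ K ∤ + x -ᶻ t ] + q ≡ q * K
nonresidue-count K q t = begin
  ∑[ x < q * K ] [ K ∤ + x -ᶻ t ] + q
    ≡⟨ cong (_+_ (∑[ x < q * K ] [ K ∤ + x -ᶻ t ])) (residue-count K q t) ⟨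
  ∑[ x < q * K ] [ K ∤ + x -ᶻ t ] + ∑[ x < q * K ] [ K ∣ + x -ᶻ t ]
    ≡⟨ ∑-distrib-+ (q * K) _ _ ⟨
  ∑[ x < q * K ] ([ K ∤ + x -ᶻ t ] + [ K ∣ + x -ᶻ t ])
    ≡⟨ ∑-cong (q * K) (λ x → 𝟙-¬+𝟙 (K ∣? ∣ + x -ᶻ t ∣)) ⟩
  ∑[ x < q * K ] 1
    ≡⟨ trans (∑-const (q * K) 1) (*-identityʳ (q * K)) ⟩
  q * K ∎
  where open ≡-Reasoning

-- The ℓ-adic valuation

downward-search-fails : {P : ℕ → Set} (P? : ∀ k → Dec (P k)) (g : ℕ → ℕ) → g 0 ≡ 0 →
  (∀ k → g (suc k) ≡ (if does (P? (suc k)) then suc k else g k)) →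
  (∀ k → ¬ P (suc k)) → ∀ k → g k ≡ 0
downward-search-fails P? g g0 g-suc ¬P zero = g0
downward-search-fails P? g g0 g-suc ¬P (suc k) with P? (suc k) | g-suc k
... | yes p | _  = contradiction p (¬P k)
... | no _  | eq = trans eq (downward-search-fails P? g g0 g-suc ¬P k)

-- The search inside ν is a where-bound function and cannot be named; ν-from recovers it by
-- unification with the one-step unfolding ν-suc.
mutual
  ν-from : ℕ → ℕ → ℕ → ℕ
  ν-from = _

  ν-suc : ∀ ℓ k → ν ℓ (suc k) ≡ (if does ((ℓ ^ suc k) ∣? suc k) then suc k else ν-from ℓ (suc k) k)
  ν-suc ℓ k with suc k
  ... | n = refl

ν≡0 : ∀ ℓ n → ¬ ℓ ∣ n → ν ℓ n ≡ 0
ν≡0 ℓ zero    ℓ∤n = refl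
ν≡0 ℓ (suc k) ℓ∤n = trans (ν-suc ℓ k)
  (downward-search-fails (λ j → (ℓ ^ j) ∣? suc k) (ν-from ℓ (suc k)) refl (λ _ → refl)
    (λ j ℓʲ⁺¹∣n → ℓ∤n (∣-trans (m∣m*n (ℓ ^ j)) ℓʲ⁺¹∣n)) (suc k))

-- Counting C_{N,n}(ℓ^e)

-- The exponent is shifted: the modulus is m = ℓ^(1+e), so e here is e − 1 in the theorem.
module Count (ℓ N e : ℕ) (ℓ-prime : Prime ℓ) (ℓ∤N : ¬ ℓ ∣ N) where

  instance
    ℓ-nonZero : NonZero ℓ
    ℓ-nonZero = prime⇒nonZero ℓ-prime

  p m : ℕ
  p = ℓ ^ e
  m = ℓ ^ suc e

  instance
    m-nonZero : NonZero m
    m-nonZero = m^n≢0 ℓ (suc e)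

  Δ : ℕ → ℕ → ℕ → ℕ → ℤ
  Δ a b c d = ((+ a *ᶻ + d -ᶻ + b *ᶻ + c) +ᶻ + 1 -ᶻ (+ a +ᶻ + d)) -ᶻ + N

  T : ℕ → ℕ → ℤ
  T a d = + a +ᶻ + d +ᶻ + N -ᶻ + 1

  R : ℕ → ℕ → ℤ
  R a d = (+ a -ᶻ + 1) *ᶻ (+ d -ᶻ + 1) -ᶻ + N

  K : ℕ → ℤ
  K a = + a *ᶻ (+ a +ᶻ + N -ᶻ + 1)

  inC : ℕ → ℕ → ℕ → ℕ → ℕ
  inC a b c d = [ m ∣ Δ a b c d ] * [ ℓ ∤ T a d ]

  good : ℕ → ℕ
  good a = [ ℓ ∤ + a -ᶻ + 1 ] * [ ℓ ∤ K a ]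

  φ : ℕ
  φ = ∑[ c < m ] [ ℓ ∤ + c ]

  ∑⁴ : (ℕ → ℕ → ℕ → ℕ → ℕ) → ℕ
  ∑⁴ f = ∑[ a < m ] ∑[ b < m ] ∑[ c < m ] ∑[ d < m ] f a b c d

  Δ≡det-T : ∀ a b c d → Δ a b c d ≡ (+ a *ᶻ + d -ᶻ + b *ᶻ + c) -ᶻ T a d
  Δ≡det-T a b c d = identity (+ a) (+ b) (+ c) (+ d) (+ N)
    where
    identity : ∀ a b c d N → ((a *ᶻ d -ᶻ b *ᶻ c) +ᶻ + 1 -ᶻ (a +ᶻ d)) -ᶻ N
                             ≡ (a *ᶻ d -ᶻ b *ᶻ c) -ᶻ (a +ᶻ d +ᶻ N -ᶻ + 1)
    identity = solve-∀

  Δ≡R-bc : ∀ a b c d → Δ a b c d ≡ R a d -ᶻ + b *ᶻ + c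
  Δ≡R-bc a b c d = identity (+ a) (+ b) (+ c) (+ d) (+ N)
    where
    identity : ∀ a b c d N → ((a *ᶻ d -ᶻ b *ᶻ c) +ᶻ + 1 -ᶻ (a +ᶻ d)) -ᶻ N
                             ≡ ((a -ᶻ + 1) *ᶻ (d -ᶻ + 1) -ᶻ N) -ᶻ b *ᶻ c
    identity = solve-∀

  K≡[a-1]T-R : ∀ a d → K a ≡ (+ a -ᶻ + 1) *ᶻ T a d -ᶻ R a d
  K≡[a-1]T-R a d = identity (+ a) (+ d) (+ N)
    where
    identity : ∀ a d N → a *ᶻ (a +ᶻ N -ᶻ + 1)
                         ≡ (a -ᶻ + 1) *ᶻ (a +ᶻ d +ᶻ N -ᶻ + 1) -ᶻ ((a -ᶻ + 1) *ᶻ (d -ᶻ + 1) -ᶻ N)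
    identity = solve-∀

  ℓ∣m : + ℓ ∣ᶻ + m
  ℓ∣m = ∣ᵤ⇒∣ (m∣m*n p)

  m∣⇒ℓ∣ : ∀ {x} → + m ∣ᶻ x → + ℓ ∣ᶻ x
  m∣⇒ℓ∣ = ∣ᶻ-trans ℓ∣m

  ℓ∣R⇒ℓ∤a-1 : ∀ a d → + ℓ ∣ᶻ R a d → ¬ + ℓ ∣ᶻ + a -ᶻ + 1
  ℓ∣R⇒ℓ∤a-1 a d ℓ∣R ℓ∣a-1 =
    ℓ∤N (∣⇒∣ᵤ (∣-lincomb (+ d -ᶻ + 1) (-ᶻ + 1) ℓ∣a-1 ℓ∣R (identity (+ a) (+ d) (+ N))))
    where
    identity : ∀ a d N → N ≡ (d -ᶻ + 1) *ᶻ (a -ᶻ + 1) +ᶻ (-ᶻ + 1) *ᶻ ((a -ᶻ + 1) *ᶻ (d -ᶻ + 1) -ᶻ N)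
    identity = solve-∀

  ℓ∣R⇒[ℓ∤T]≡[ℓ∤K] : ∀ a d → + ℓ ∣ᶻ R a d → [ ℓ ∤ T a d ] ≡ [ ℓ ∤ K a ]
  ℓ∣R⇒[ℓ∤T]≡[ℓ∤K] a d ℓ∣R =
    𝟙-¬-cong (ℓ ∣? ∣ T a d ∣) (ℓ ∣? ∣ K a ∣) (𝟙-cong (ℓ ∣? ∣ T a d ∣) (ℓ ∣? ∣ K a ∣)
    (λ ℓ∣T → ∣⇒∣ᵤ (subst (+ ℓ ∣ᶻ_) (sym (K≡[a-1]T-R a d))
      (∣m∣n⇒∣m-n (∣n⇒∣m*n (+ a -ᶻ + 1) (∣ᵤ⇒∣ ℓ∣T)) ℓ∣R)))
    (λ ℓ∣K → ∣⇒∣ᵤ (ℓ∣T-or-ℓ∣a-1 (euclidsLemmaᶻ ℓ-prime (+ a -ᶻ + 1) (T a d)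
      (∣-diffˡ (subst (+ ℓ ∣ᶻ_) (K≡[a-1]T-R a d) (∣ᵤ⇒∣ ℓ∣K)) ℓ∣R)))))
    where
    ℓ∣T-or-ℓ∣a-1 : + ℓ ∣ᶻ + a -ᶻ + 1 ⊎ + ℓ ∣ᶻ T a d → + ℓ ∣ᶻ T a d
    ℓ∣T-or-ℓ∣a-1 (inj₁ ℓ∣a-1) = contradiction ℓ∣a-1 (ℓ∣R⇒ℓ∤a-1 a d ℓ∣R)
    ℓ∣T-or-ℓ∣a-1 (inj₂ ℓ∣T)   = ℓ∣T

  m∣Δ⇒ℓ∣c⇒ℓ∣R : ∀ a b c d → + m ∣ᶻ Δ a b c d → + ℓ ∣ᶻ + c → + ℓ ∣ᶻ R a d
  m∣Δ⇒ℓ∣c⇒ℓ∣R a b c d m∣Δ ℓ∣c =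
    ∣-diffˡ (subst (+ ℓ ∣ᶻ_) (Δ≡R-bc a b c d) (m∣⇒ℓ∣ m∣Δ)) (∣n⇒∣m*n (+ b) ℓ∣c)

  ∑-m≡∑-pℓ : ∀ f → ∑ m f ≡ ∑ (p * ℓ) f
  ∑-m≡∑-pℓ f = cong (λ k → ∑ k f) (*-comm ℓ p)

  ∑m-residue : ∀ t → ∑[ x < m ] [ ℓ ∣ + x -ᶻ t ] ≡ p
  ∑m-residue t = trans (∑-m≡∑-pℓ _) (residue-count ℓ p t)

  ∑m-nonresidue : ∀ t → ∑[ x < m ] [ ℓ ∤ + x -ᶻ t ] + p ≡ m
  ∑m-nonresidue t = trans (cong (_+ p) (∑-m≡∑-pℓ _)) (trans (nonresidue-count ℓ p t) (*-comm p ℓ))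

  +x≡+x-0 : ∀ x → + x ≡ + x -ᶻ + 0
  +x≡+x-0 x = sym (ℤ.+-identityʳ (+ x))

  ∑c-[ℓ∣c] : ∑[ c < m ] [ ℓ ∣ + c ] ≡ p
  ∑c-[ℓ∣c] = trans (∑-cong m (λ c → cong [ ℓ ∣_] (+x≡+x-0 c))) (∑m-residue (+ 0))

  φ+p≡m : φ + p ≡ m
  φ+p≡m = trans (cong (_+ p) (∑-cong m (λ c → cong [ ℓ ∤_] (+x≡+x-0 c)))) (∑m-nonresidue (+ 0))

  ∑d-[ℓ∤T] : ∀ a → ∑[ d < m ] [ ℓ ∤ T a d ] ≡ φ
  ∑d-[ℓ∤T] a = +-cancelʳ-≡ p _ _ (trans
    (cong (_+ p) (∑-cong m (λ d → cong [ ℓ ∤_] (identity (+ a) (+ d) (+ N)))))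
    (trans (∑m-nonresidue (-ᶻ (+ a +ᶻ + N -ᶻ + 1))) (sym φ+p≡m)))
    where
    identity : ∀ a d N → a +ᶻ d +ᶻ N -ᶻ + 1 ≡ d -ᶻ (-ᶻ (a +ᶻ N -ᶻ + 1))
    identity = solve-∀

  ∑d-[ℓ∣R] : ∀ a → ¬ ℓ ∣ ∣ + a -ᶻ + 1 ∣ → ∑[ d < m ] [ ℓ ∣ R a d ] ≡ p
  ∑d-[ℓ∣R] a ℓ∤a-1 = trans (∑-cong m (λ d → cong [ ℓ ∣_] (identity (+ a) (+ d) (+ N))))
    (trans (∑-m≡∑-pℓ _) (linear-congruence-count ℓ p (+ a -ᶻ + 1) _
      (invertible-mod-prime ℓ-prime {+ a -ᶻ + 1} ℓ∤a-1)))
    where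
    identity : ∀ a d N → (a -ᶻ + 1) *ᶻ (d -ᶻ + 1) -ᶻ N ≡ (a -ᶻ + 1) *ᶻ d -ᶻ ((a -ᶻ + 1) +ᶻ N)
    identity = solve-∀

  ∑b-[m∣Δ] : ∀ a c d → ¬ ℓ ∣ c → ∑[ b < m ] [ m ∣ Δ a b c d ] ≡ 1
  ∑b-[m∣Δ] a c d ℓ∤c = trans (∑-cong m (λ b → [∣]-neg m (identity (+ a) (+ b) (+ c) (+ d) (+ N))))
    (linear-congruence-count₁ m (+ c) _ (invertible-mod-prime^ ℓ-prime {+ c} ℓ∤c (suc e)))
    where
    identity : ∀ a b c d N → ((a *ᶻ d -ᶻ b *ᶻ c) +ᶻ + 1 -ᶻ (a +ᶻ d)) -ᶻ N
                             ≡ -ᶻ (c *ᶻ b -ᶻ ((a *ᶻ d +ᶻ + 1 -ᶻ (a +ᶻ d)) -ᶻ N))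
    identity = solve-∀

  ∑c-[m∣Δ] : ∀ a b d → ¬ ℓ ∣ b → ∑[ c < m ] [ m ∣ Δ a b c d ] ≡ 1
  ∑c-[m∣Δ] a b d ℓ∤b = trans (∑-cong m (λ c → [∣]-neg m (identity (+ a) (+ b) (+ c) (+ d) (+ N))))
    (linear-congruence-count₁ m (+ b) _ (invertible-mod-prime^ ℓ-prime {+ b} ℓ∤b (suc e)))
    where
    identity : ∀ a b c d N → ((a *ᶻ d -ᶻ b *ᶻ c) +ᶻ + 1 -ᶻ (a +ᶻ d)) -ᶻ N
                             ≡ -ᶻ (b *ᶻ c -ᶻ ((a *ᶻ d +ᶻ + 1 -ᶻ (a +ᶻ d)) -ᶻ N))
    identity = solve-∀

  ∑d-[m∣Δ] : ∀ a b c → ¬ ℓ ∣ ∣ + a -ᶻ + 1 ∣ → ∑[ d < m ] [ m ∣ Δ a b c d ] ≡ 1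
  ∑d-[m∣Δ] a b c ℓ∤a-1 = trans (∑-cong m (λ d → cong [ m ∣_] (identity (+ a) (+ b) (+ c) (+ d) (+ N))))
    (linear-congruence-count₁ m (+ a -ᶻ + 1) _
      (invertible-mod-prime^ ℓ-prime {+ a -ᶻ + 1} ℓ∤a-1 (suc e)))
    where
    identity : ∀ a b c d N → ((a *ᶻ d -ᶻ b *ᶻ c) +ᶻ + 1 -ᶻ (a +ᶻ d)) -ᶻ N
                             ≡ (a -ᶻ + 1) *ᶻ d -ᶻ ((a -ᶻ + 1) +ᶻ N +ᶻ b *ᶻ c)
    identity = solve-∀

  m∣Δ⇒[ℓ∣c]≡[ℓ∣R] : ∀ a b c d → ¬ ℓ ∣ b → + m ∣ᶻ Δ a b c d → [ ℓ ∣ + c ] ≡ [ ℓ ∣ R a d ]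
  m∣Δ⇒[ℓ∣c]≡[ℓ∣R] a b c d ℓ∤b m∣Δ = 𝟙-cong (ℓ ∣? c) (ℓ ∣? ∣ R a d ∣)
    (λ ℓ∣c → ∣⇒∣ᵤ (m∣Δ⇒ℓ∣c⇒ℓ∣R a b c d m∣Δ (∣ᵤ⇒∣ ℓ∣c)))
    (λ ℓ∣R → ℓ∣c (euclidsLemmaᶻ ℓ-prime (+ b) (+ c)
      (∣-diffʳ {x = R a d} (subst (+ ℓ ∣ᶻ_) (Δ≡R-bc a b c d) (m∣⇒ℓ∣ m∣Δ)) (∣ᵤ⇒∣ ℓ∣R))))
    where
    ℓ∣c : + ℓ ∣ᶻ + b ⊎ + ℓ ∣ᶻ + c → ℓ ∣ c
    ℓ∣c (inj₁ ℓ∣b) = contradiction (∣⇒∣ᵤ ℓ∣b) ℓ∤b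
    ℓ∣c (inj₂ ℓ∣c) = ∣⇒∣ᵤ ℓ∣c

  ∑d-[ℓ∣R][ℓ∤T] : ∀ a → ∑[ d < m ] ([ ℓ ∣ R a d ] * [ ℓ ∤ T a d ]) ≡ p * good a
  ∑d-[ℓ∣R][ℓ∤T] a with ℓ ∣? ∣ + a -ᶻ + 1 ∣
  ... | yes ℓ∣a-1 = trans (∑-zero m _ (λ d _ → cong (_* [ ℓ ∤ T a d ])
          (𝟙-no (ℓ ∣? ∣ R a d ∣) (λ ℓ∣R → ℓ∣R⇒ℓ∤a-1 a d (∣ᵤ⇒∣ ℓ∣R) (∣ᵤ⇒∣ ℓ∣a-1)))))
        (sym (*-zeroʳ p))
  ... | no ℓ∤a-1 = begin
    ∑[ d < m ] ([ ℓ ∣ R a d ] * [ ℓ ∤ T a d ])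
      ≡⟨ ∑-cong m (λ d → 𝟙-*-cong (ℓ ∣? ∣ R a d ∣) (ℓ∣R⇒[ℓ∤T]≡[ℓ∤K] a d ∘ ∣ᵤ⇒∣)) ⟩
    ∑[ d < m ] ([ ℓ ∣ R a d ] * [ ℓ ∤ K a ])
      ≡⟨ ∑-*ʳ m [ ℓ ∤ K a ] _ ⟩
    ∑[ d < m ] [ ℓ ∣ R a d ] * [ ℓ ∤ K a ]
      ≡⟨ cong (_* [ ℓ ∤ K a ]) (∑d-[ℓ∣R] a ℓ∤a-1) ⟩
    p * [ ℓ ∤ K a ]
      ≡⟨ cong (p *_) (*-identityˡ [ ℓ ∤ K a ]) ⟨
    p * (1 * [ ℓ ∤ K a ]) ∎
    where open ≡-Reasoning

  ∑d-inC : ∀ a b c → ℓ ∣ c → ∑[ d < m ] inC a b c d ≡ good a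
  ∑d-inC a b c ℓ∣c with ℓ ∣? ∣ + a -ᶻ + 1 ∣
  ... | yes ℓ∣a-1 = ∑-zero m _ (λ d _ → cong (_* [ ℓ ∤ T a d ])
          (𝟙-no (m ∣? ∣ Δ a b c d ∣) (λ m∣Δ → ℓ∣R⇒ℓ∤a-1 a d
            (m∣Δ⇒ℓ∣c⇒ℓ∣R a b c d (∣ᵤ⇒∣ m∣Δ) (∣ᵤ⇒∣ ℓ∣c)) (∣ᵤ⇒∣ ℓ∣a-1))))
  ... | no ℓ∤a-1 = begin
    ∑[ d < m ] ([ m ∣ Δ a b c d ] * [ ℓ ∤ T a d ])
      ≡⟨ ∑-cong m (λ d → 𝟙-*-cong (m ∣? ∣ Δ a b c d ∣) (λ m∣Δ →
           ℓ∣R⇒[ℓ∤T]≡[ℓ∤K] a d (m∣Δ⇒ℓ∣c⇒ℓ∣R a b c d (∣ᵤ⇒∣ m∣Δ) (∣ᵤ⇒∣ ℓ∣c)))) ⟩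
    ∑[ d < m ] ([ m ∣ Δ a b c d ] * [ ℓ ∤ K a ])
      ≡⟨ ∑-*ʳ m [ ℓ ∤ K a ] _ ⟩
    ∑[ d < m ] [ m ∣ Δ a b c d ] * [ ℓ ∤ K a ]
      ≡⟨ cong (_* [ ℓ ∤ K a ]) (∑d-[m∣Δ] a b c ℓ∤a-1) ⟩
    1 * [ ℓ ∤ K a ] ∎
    where open ≡-Reasoning

  ∑⁴-reorder-adcb : ∀ f → ∑⁴ f ≡ ∑[ a < m ] ∑[ d < m ] ∑[ c < m ] ∑[ b < m ] f a b c d
  ∑⁴-reorder-adcb f = ∑-cong m (λ a →
    trans (∑-comm m m (λ b c → ∑[ d < m ] f a b c d))
      (trans (∑-cong m (λ c → ∑-comm m m (λ b d → f a b c d)))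
        (∑-comm m m (λ c d → ∑[ b < m ] f a b c d))))

  ∑⁴-reorder-abdc : ∀ f → ∑⁴ f ≡ ∑[ a < m ] ∑[ b < m ] ∑[ d < m ] ∑[ c < m ] f a b c d
  ∑⁴-reorder-abdc f = ∑-cong m (λ a → ∑-cong m (λ b → ∑-comm m m (λ c d → f a b c d)))

  ∑-unit-c : ∑⁴ (λ a b c d → [ ℓ ∤ + c ] * inC a b c d) ≡ m * (φ * φ)
  ∑-unit-c = begin
    ∑⁴ (λ a b c d → [ ℓ ∤ + c ] * inC a b c d)
      ≡⟨ ∑⁴-reorder-adcb _ ⟩
    ∑[ a < m ] ∑[ d < m ] ∑[ c < m ] ∑[ b < m ] ([ ℓ ∤ + c ] * inC a b c d)
      ≡⟨ ∑-cong m (λ a → ∑-cong m (λ d → ∑-cong m (λ c → ∑-over-b a c d))) ⟩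
    ∑[ a < m ] ∑[ d < m ] ∑[ c < m ] ([ ℓ ∤ + c ] * [ ℓ ∤ T a d ])
      ≡⟨ ∑-cong m (λ a → ∑-cong m (λ d → ∑-*ʳ m [ ℓ ∤ T a d ] _)) ⟩
    ∑[ a < m ] ∑[ d < m ] (φ * [ ℓ ∤ T a d ])
      ≡⟨ ∑-cong m (λ a → trans (∑-*ˡ m φ _) (cong (φ *_) (∑d-[ℓ∤T] a))) ⟩
    ∑[ a < m ] (φ * φ)
      ≡⟨ ∑-const m (φ * φ) ⟩
    m * (φ * φ) ∎
    where
    open ≡-Reasoning
    rearrange : ∀ x y z → x * (y * z) ≡ (x * z) * y
    rearrange = ℕ-Solver.solve-∀
    ∑-over-b : ∀ a c d → ∑[ b < m ] ([ ℓ ∤ + c ] * inC a b c d) ≡ [ ℓ ∤ + c ] * [ ℓ ∤ T a d ]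
    ∑-over-b a c d = begin
      ∑[ b < m ] ([ ℓ ∤ + c ] * ([ m ∣ Δ a b c d ] * [ ℓ ∤ T a d ]))
        ≡⟨ ∑-cong m (λ b → rearrange [ ℓ ∤ + c ] [ m ∣ Δ a b c d ] [ ℓ ∤ T a d ]) ⟩
      ∑[ b < m ] ([ ℓ ∤ + c ] * [ ℓ ∤ T a d ] * [ m ∣ Δ a b c d ])
        ≡⟨ trans (∑-*ˡ m ([ ℓ ∤ + c ] * [ ℓ ∤ T a d ]) (λ b → [ m ∣ Δ a b c d ]))
             (*-assoc [ ℓ ∤ + c ] _ _) ⟩
      [ ℓ ∤ + c ] * ([ ℓ ∤ T a d ] * ∑[ b < m ] [ m ∣ Δ a b c d ])
        ≡⟨ 𝟙-*-cong (¬? (ℓ ∣? c)) (λ ℓ∤c →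
             trans (cong ([ ℓ ∤ T a d ] *_) (∑b-[m∣Δ] a c d ℓ∤c)) (*-identityʳ _)) ⟩
      [ ℓ ∤ + c ] * [ ℓ ∤ T a d ] ∎

  ∑-nonunit-c-unit-b :
    ∑⁴ (λ a b c d → [ ℓ ∣ + c ] * [ ℓ ∤ + b ] * inC a b c d) ≡ φ * (p * ∑[ a < m ] good a)
  ∑-nonunit-c-unit-b = begin
    ∑⁴ (λ a b c d → [ ℓ ∣ + c ] * [ ℓ ∤ + b ] * inC a b c d)
      ≡⟨ ∑⁴-reorder-abdc _ ⟩
    ∑[ a < m ] ∑[ b < m ] ∑[ d < m ] ∑[ c < m ] ([ ℓ ∣ + c ] * [ ℓ ∤ + b ] * inC a b c d)
      ≡⟨ ∑-cong m (λ a → ∑-cong m (λ b → ∑-cong m (λ d → ∑-over-c a b d))) ⟩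
    ∑[ a < m ] ∑[ b < m ] ∑[ d < m ] ([ ℓ ∤ + b ] * ([ ℓ ∣ R a d ] * [ ℓ ∤ T a d ]))
      ≡⟨ ∑-cong m (λ a → ∑-cong m (λ b → trans (∑-*ˡ m [ ℓ ∤ + b ] _)
           (cong ([ ℓ ∤ + b ] *_) (∑d-[ℓ∣R][ℓ∤T] a)))) ⟩
    ∑[ a < m ] ∑[ b < m ] ([ ℓ ∤ + b ] * (p * good a))
      ≡⟨ ∑-cong m (λ a → ∑-*ʳ m (p * good a) _) ⟩
    ∑[ a < m ] (φ * (p * good a))
      ≡⟨ trans (∑-*ˡ m φ _) (cong (φ *_) (∑-*ˡ m p good)) ⟩
    φ * (p * ∑[ a < m ] good a) ∎
    where
    open ≡-Reasoning
    rearrange : ∀ x y z w → x * y * (z * w) ≡ (y * w) * (z * x)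
    rearrange = ℕ-Solver.solve-∀
    ∑-over-c : ∀ a b d → ∑[ c < m ] ([ ℓ ∣ + c ] * [ ℓ ∤ + b ] * inC a b c d)
                         ≡ [ ℓ ∤ + b ] * ([ ℓ ∣ R a d ] * [ ℓ ∤ T a d ])
    ∑-over-c a b d = begin
      ∑[ c < m ] ([ ℓ ∣ + c ] * [ ℓ ∤ + b ] * ([ m ∣ Δ a b c d ] * [ ℓ ∤ T a d ]))
        ≡⟨ ∑-cong m (λ c → rearrange [ ℓ ∣ + c ] [ ℓ ∤ + b ] [ m ∣ Δ a b c d ] [ ℓ ∤ T a d ]) ⟩
      ∑[ c < m ] ([ ℓ ∤ + b ] * [ ℓ ∤ T a d ] * ([ m ∣ Δ a b c d ] * [ ℓ ∣ + c ]))
        ≡⟨ trans (∑-*ˡ m ([ ℓ ∤ + b ] * [ ℓ ∤ T a d ]) (λ c → [ m ∣ Δ a b c d ] * [ ℓ ∣ + c ]))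
             (*-assoc [ ℓ ∤ + b ] _ _) ⟩
      [ ℓ ∤ + b ] * ([ ℓ ∤ T a d ] * ∑[ c < m ] ([ m ∣ Δ a b c d ] * [ ℓ ∣ + c ]))
        ≡⟨ 𝟙-*-cong (¬? (ℓ ∣? b)) (λ ℓ∤b → cong ([ ℓ ∤ T a d ] *_) (∑c-[m∣Δ][ℓ∣c] ℓ∤b)) ⟩
      [ ℓ ∤ + b ] * ([ ℓ ∤ T a d ] * [ ℓ ∣ R a d ])
        ≡⟨ cong ([ ℓ ∤ + b ] *_) (*-comm [ ℓ ∤ T a d ] _) ⟩
      [ ℓ ∤ + b ] * ([ ℓ ∣ R a d ] * [ ℓ ∤ T a d ]) ∎
      where
      ∑c-[m∣Δ][ℓ∣c] : ¬ ℓ ∣ b → ∑[ c < m ] ([ m ∣ Δ a b c d ] * [ ℓ ∣ + c ]) ≡ [ ℓ ∣ R a d ]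
      ∑c-[m∣Δ][ℓ∣c] ℓ∤b = begin
        ∑[ c < m ] ([ m ∣ Δ a b c d ] * [ ℓ ∣ + c ])
          ≡⟨ ∑-cong m (λ c → 𝟙-*-cong (m ∣? ∣ Δ a b c d ∣)
               (m∣Δ⇒[ℓ∣c]≡[ℓ∣R] a b c d ℓ∤b ∘ ∣ᵤ⇒∣)) ⟩
        ∑[ c < m ] ([ m ∣ Δ a b c d ] * [ ℓ ∣ R a d ])
          ≡⟨ ∑-*ʳ m [ ℓ ∣ R a d ] _ ⟩
        ∑[ c < m ] [ m ∣ Δ a b c d ] * [ ℓ ∣ R a d ]
          ≡⟨ cong (_* [ ℓ ∣ R a d ]) (∑c-[m∣Δ] a b d ℓ∤b) ⟩
        1 * [ ℓ ∣ R a d ]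
          ≡⟨ *-identityˡ _ ⟩
        [ ℓ ∣ R a d ] ∎

  ∑-nonunit-bc : ∑⁴ (λ a b c d → [ ℓ ∣ + c ] * [ ℓ ∣ + b ] * inC a b c d) ≡ p * (p * ∑[ a < m ] good a)
  ∑-nonunit-bc = begin
    ∑⁴ (λ a b c d → [ ℓ ∣ + c ] * [ ℓ ∣ + b ] * inC a b c d)
      ≡⟨ ∑-cong m (λ a → ∑-cong m (λ b → ∑-cong m (λ c → ∑-over-d a b c))) ⟩
    ∑[ a < m ] ∑[ b < m ] ∑[ c < m ] ([ ℓ ∣ + c ] * ([ ℓ ∣ + b ] * good a))
      ≡⟨ ∑-cong m (λ a → ∑-cong m (λ b → trans (∑-*ʳ m ([ ℓ ∣ + b ] * good a) _)
           (cong (_* ([ ℓ ∣ + b ] * good a)) ∑c-[ℓ∣c]))) ⟩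
    ∑[ a < m ] ∑[ b < m ] (p * ([ ℓ ∣ + b ] * good a))
      ≡⟨ ∑-cong m (λ a → trans (∑-*ˡ m p _)
           (cong (p *_) (trans (∑-*ʳ m (good a) _) (cong (_* good a) ∑c-[ℓ∣c])))) ⟩
    ∑[ a < m ] (p * (p * good a))
      ≡⟨ trans (∑-*ˡ m p _) (cong (p *_) (∑-*ˡ m p good)) ⟩
    p * (p * ∑[ a < m ] good a) ∎
    where
    open ≡-Reasoning
    ∑-over-d : ∀ a b c → ∑[ d < m ] ([ ℓ ∣ + c ] * [ ℓ ∣ + b ] * inC a b c d)
                         ≡ [ ℓ ∣ + c ] * ([ ℓ ∣ + b ] * good a)
    ∑-over-d a b c = trans (∑-*ˡ m ([ ℓ ∣ + c ] * [ ℓ ∣ + b ]) (inC a b c)) (trans (*-assoc [ ℓ ∣ + c ] _ _)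
      (𝟙-*-cong (ℓ ∣? c) (λ ℓ∣c → cong ([ ℓ ∣ + b ] *_) (∑d-inC a b c ℓ∣c))))

  good-periodic : ∀ a → good (ℓ + a) ≡ good a
  good-periodic a = cong₂ _*_
    ([∤]-cong (+ (ℓ + a) -ᶻ + 1) (+ a -ᶻ + 1) (dividesᶻ (+ 1)
      (trans (cong (λ t → (t -ᶻ + 1) -ᶻ (+ a -ᶻ + 1)) (ℤ.pos-+ ℓ a)) (shift-a-1 (+ ℓ) (+ a)))))
    ([∤]-cong (K (ℓ + a)) (K a) (dividesᶻ (+ 2 *ᶻ + a +ᶻ + ℓ +ᶻ + N -ᶻ + 1)
      (trans (cong (λ t → t *ᶻ (t +ᶻ + N -ᶻ + 1) -ᶻ K a) (ℤ.pos-+ ℓ a)) (shift-K (+ ℓ) (+ a) (+ N)))))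
    where
    shift-a-1 : ∀ ℓ a → (ℓ +ᶻ a -ᶻ + 1) -ᶻ (a -ᶻ + 1) ≡ + 1 *ᶻ ℓ
    shift-a-1 = solve-∀
    shift-K : ∀ ℓ a N → (ℓ +ᶻ a) *ᶻ ((ℓ +ᶻ a) +ᶻ N -ᶻ + 1) -ᶻ a *ᶻ (a +ᶻ N -ᶻ + 1)
                        ≡ (+ 2 *ᶻ a +ᶻ ℓ +ᶻ N -ᶻ + 1) *ᶻ ℓ
    shift-K = solve-∀

  ∑a-good : ∑[ a < m ] good a ≡ p * ∑[ a < ℓ ] good a
  ∑a-good = trans (∑-m≡∑-pℓ good) (∑-periodic ℓ p good good-periodic)

  good+excluded : ∀ a → good a + ([ ℓ ∣ + a -ᶻ + 1 ] + ([ ℓ ∣ + a ] + [ ℓ ∣ + a +ᶻ + N -ᶻ + 1 ]))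
                        ≡ 1 + [ ℓ ∣ + a ] * [ ℓ ∣ + N -ᶻ + 1 ]
  good+excluded a = cases (ℓ ∣? ∣ + a -ᶻ + 1 ∣) (ℓ ∣? a) (ℓ ∣? ∣ + a +ᶻ + N -ᶻ + 1 ∣)
                          (ℓ ∣? ∣ K a ∣) (ℓ ∣? ∣ + N -ᶻ + 1 ∣)
    where
    1≡a-[a-1] : ∀ a → + 1 ≡ + 1 *ᶻ a +ᶻ (-ᶻ + 1) *ᶻ (a -ᶻ + 1)
    1≡a-[a-1] = solve-∀
    N≡[a+N-1]-[a-1] : ∀ a N → N ≡ + 1 *ᶻ (a +ᶻ N -ᶻ + 1) +ᶻ (-ᶻ + 1) *ᶻ (a -ᶻ + 1)
    N≡[a+N-1]-[a-1] = solve-∀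
    N-1≡[a+N-1]-a : ∀ a N → N -ᶻ + 1 ≡ + 1 *ᶻ (a +ᶻ N -ᶻ + 1) +ᶻ (-ᶻ + 1) *ᶻ a
    N-1≡[a+N-1]-a = solve-∀
    a+N-1≡[N-1]+a : ∀ a N → a +ᶻ N -ᶻ + 1 ≡ + 1 *ᶻ (N -ᶻ + 1) +ᶻ + 1 *ᶻ a
    a+N-1≡[N-1]+a = solve-∀
    ℓ∣ : ∀ x → ℓ ∣ ∣ x ∣ → + ℓ ∣ᶻ x
    ℓ∣ x = ∣ᵤ⇒∣
    -- The excluded residues a ≡ 1, a ≡ 0 and a ≡ 1 − N are distinct, except that the last two
    -- coincide when ℓ ∣ N − 1.
    cases : (ℓ∣a-1? : Dec (ℓ ∣ ∣ + a -ᶻ + 1 ∣)) (ℓ∣a? : Dec (ℓ ∣ a))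
            (ℓ∣a+N-1? : Dec (ℓ ∣ ∣ + a +ᶻ + N -ᶻ + 1 ∣)) (ℓ∣K? : Dec (ℓ ∣ ∣ K a ∣))
            (ℓ∣N-1? : Dec (ℓ ∣ ∣ + N -ᶻ + 1 ∣)) →
            𝟙 (¬? ℓ∣a-1?) * 𝟙 (¬? ℓ∣K?) + (𝟙 ℓ∣a-1? + (𝟙 ℓ∣a? + 𝟙 ℓ∣a+N-1?))
            ≡ 1 + 𝟙 ℓ∣a? * 𝟙 ℓ∣N-1?
    cases (yes ℓ∣a-1) (yes ℓ∣a) _ _ _ =
      contradiction (∣-lincomb (+ 1) (-ᶻ + 1) (ℓ∣ (+ a) ℓ∣a) (ℓ∣ (+ a -ᶻ + 1) ℓ∣a-1) (1≡a-[a-1] (+ a)))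
        (prime∤1 ℓ-prime)
    cases (yes ℓ∣a-1) (no _) (yes ℓ∣a+N-1) _ _ =
      contradiction (∣⇒∣ᵤ (∣-lincomb (+ 1) (-ᶻ + 1) (ℓ∣ (+ a +ᶻ + N -ᶻ + 1) ℓ∣a+N-1) (ℓ∣ (+ a -ᶻ + 1) ℓ∣a-1)
        (N≡[a+N-1]-[a-1] (+ a) (+ N)))) ℓ∤N
    cases (yes _) (no _) (no _) _ _ = refl
    cases (no _) (yes ℓ∣a) _ (no ℓ∤K) _ =
      contradiction (∣⇒∣ᵤ (∣m⇒∣m*n {m = + a} (+ a +ᶻ + N -ᶻ + 1) (ℓ∣ (+ a) ℓ∣a))) ℓ∤K
    cases (no _) (yes _) (yes _) (yes _) (yes _) = refl
    cases (no _) (yes ℓ∣a) (yes ℓ∣a+N-1) (yes _) (no ℓ∤N-1) =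
      contradiction (∣⇒∣ᵤ (∣-lincomb (+ 1) (-ᶻ + 1) (ℓ∣ (+ a +ᶻ + N -ᶻ + 1) ℓ∣a+N-1) (ℓ∣ (+ a) ℓ∣a)
        (N-1≡[a+N-1]-a (+ a) (+ N)))) ℓ∤N-1
    cases (no _) (yes ℓ∣a) (no ℓ∤a+N-1) (yes _) (yes ℓ∣N-1) =
      contradiction (∣⇒∣ᵤ (∣-lincomb (+ 1) (+ 1) (ℓ∣ (+ N -ᶻ + 1) ℓ∣N-1) (ℓ∣ (+ a) ℓ∣a)
        (a+N-1≡[N-1]+a (+ a) (+ N)))) ℓ∤a+N-1
    cases (no _) (yes _) (no _) (yes _) (no _) = refl
    cases (no _) (no _) (yes _) (yes _) _ = refl
    cases (no _) (no _) (yes ℓ∣a+N-1) (no ℓ∤K) _ =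
      contradiction (∣⇒∣ᵤ (∣n⇒∣m*n (+ a) (ℓ∣ (+ a +ᶻ + N -ᶻ + 1) ℓ∣a+N-1))) ℓ∤K
    cases (no _) (no ℓ∤a) (no ℓ∤a+N-1) (yes ℓ∣K) _
      with euclidsLemmaᶻ ℓ-prime (+ a) (+ a +ᶻ + N -ᶻ + 1) (ℓ∣ (K a) ℓ∣K)
    ... | inj₁ ℓ∣a       = contradiction (∣⇒∣ᵤ ℓ∣a) ℓ∤a
    ... | inj₂ ℓ∣a+N-1   = contradiction (∣⇒∣ᵤ ℓ∣a+N-1) ℓ∤a+N-1
    cases (no _) (no _) (no _) (no _) _ = refl

  ∑ℓ-residue : ∀ t → ∑[ x < ℓ ] [ ℓ ∣ + x -ᶻ t ] ≡ 1
  ∑ℓ-residue t = trans (cong (λ k → ∑[ x < k ] [ ℓ ∣ + x -ᶻ t ]) (sym (*-identityˡ ℓ))) (residue-count ℓ 1 t)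

  ∑a-good-mod-ℓ : ∑[ a < ℓ ] good a + 3 ≡ ℓ + [ ℓ ∣ + N -ᶻ + 1 ]
  ∑a-good-mod-ℓ = begin
    ∑[ a < ℓ ] good a + (1 + (1 + 1))
      ≡⟨ cong (_+_ (∑[ a < ℓ ] good a))
           (cong₂ _+_ (∑ℓ-residue (+ 1)) (cong₂ _+_ ∑ℓ-[ℓ∣a] ∑ℓ-[ℓ∣a+N-1])) ⟨
    ∑[ a < ℓ ] good a + (∑[ a < ℓ ] [ ℓ ∣ + a -ᶻ + 1 ]
      + (∑[ a < ℓ ] [ ℓ ∣ + a ] + ∑[ a < ℓ ] [ ℓ ∣ + a +ᶻ + N -ᶻ + 1 ]))
      ≡⟨ cong (_+_ (∑[ a < ℓ ] good a)) (cong (_+_ (∑[ a < ℓ ] [ ℓ ∣ + a -ᶻ + 1 ])) (∑-distrib-+ ℓ _ _)) ⟨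
    ∑[ a < ℓ ] good a + (∑[ a < ℓ ] [ ℓ ∣ + a -ᶻ + 1 ]
      + ∑[ a < ℓ ] ([ ℓ ∣ + a ] + [ ℓ ∣ + a +ᶻ + N -ᶻ + 1 ]))
      ≡⟨ cong (_+_ (∑[ a < ℓ ] good a)) (∑-distrib-+ ℓ _ _) ⟨
    ∑[ a < ℓ ] good a + ∑[ a < ℓ ] ([ ℓ ∣ + a -ᶻ + 1 ] + ([ ℓ ∣ + a ] + [ ℓ ∣ + a +ᶻ + N -ᶻ + 1 ]))
      ≡⟨ ∑-distrib-+ ℓ good _ ⟨
    ∑[ a < ℓ ] (good a + ([ ℓ ∣ + a -ᶻ + 1 ] + ([ ℓ ∣ + a ] + [ ℓ ∣ + a +ᶻ + N -ᶻ + 1 ])))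
      ≡⟨ ∑-cong ℓ good+excluded ⟩
    ∑[ a < ℓ ] (1 + [ ℓ ∣ + a ] * [ ℓ ∣ + N -ᶻ + 1 ])
      ≡⟨ ∑-distrib-+ ℓ (λ _ → 1) _ ⟩
    ∑[ a < ℓ ] 1 + ∑[ a < ℓ ] ([ ℓ ∣ + a ] * [ ℓ ∣ + N -ᶻ + 1 ])
      ≡⟨ cong₂ _+_ (trans (∑-const ℓ 1) (*-identityʳ ℓ))
           (trans (∑-*ʳ ℓ _ _) (trans (cong (_* [ ℓ ∣ + N -ᶻ + 1 ]) ∑ℓ-[ℓ∣a]) (*-identityˡ _))) ⟩
    ℓ + [ ℓ ∣ + N -ᶻ + 1 ] ∎
    where
    open ≡-Reasoning
    ∑ℓ-[ℓ∣a] : ∑[ a < ℓ ] [ ℓ ∣ + a ] ≡ 1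
    ∑ℓ-[ℓ∣a] = trans (∑-cong ℓ (λ a → cong [ ℓ ∣_] (+x≡+x-0 a))) (∑ℓ-residue (+ 0))
    a+N-1≡a-[1-N] : ∀ a N → a +ᶻ N -ᶻ + 1 ≡ a -ᶻ (+ 1 -ᶻ N)
    a+N-1≡a-[1-N] = solve-∀
    ∑ℓ-[ℓ∣a+N-1] : ∑[ a < ℓ ] [ ℓ ∣ + a +ᶻ + N -ᶻ + 1 ] ≡ 1
    ∑ℓ-[ℓ∣a+N-1] = trans (∑-cong ℓ (λ a → cong [ ℓ ∣_] (a+N-1≡a-[1-N] (+ a) (+ N))))
      (∑ℓ-residue (+ 1 -ᶻ + N))

  ∑⁴-inC : ∑⁴ inC ≡ m * (φ * φ) + m * (p * (p * ∑[ a < ℓ ] good a))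
  ∑⁴-inC = begin
    ∑⁴ inC
      ≡⟨ ∑⁴-cong split ⟩
    ∑⁴ (λ a b c d → [ ℓ ∤ + c ] * inC a b c d
                   + ([ ℓ ∣ + c ] * [ ℓ ∤ + b ] * inC a b c d + [ ℓ ∣ + c ] * [ ℓ ∣ + b ] * inC a b c d))
      ≡⟨ trans (∑⁴-distrib-+ _ _) (cong (_+_ _) (∑⁴-distrib-+ _ _)) ⟩
    ∑⁴ (λ a b c d → [ ℓ ∤ + c ] * inC a b c d)
      + (∑⁴ (λ a b c d → [ ℓ ∣ + c ] * [ ℓ ∤ + b ] * inC a b c d)
         + ∑⁴ (λ a b c d → [ ℓ ∣ + c ] * [ ℓ ∣ + b ] * inC a b c d))
      ≡⟨ cong₂ _+_ ∑-unit-c (cong₂ _+_ ∑-nonunit-c-unit-b ∑-nonunit-bc) ⟩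
    m * (φ * φ) + (φ * (p * S) + p * (p * S))
      ≡⟨ cong (_+_ (m * (φ * φ))) (trans (sym (*-distribʳ-+ (p * S) φ p)) (cong (_* (p * S)) φ+p≡m)) ⟩
    m * (φ * φ) + m * (p * S)
      ≡⟨ cong (λ t → m * (φ * φ) + m * (p * t)) ∑a-good ⟩
    m * (φ * φ) + m * (p * (p * ∑[ a < ℓ ] good a)) ∎
    where
    open ≡-Reasoning
    S = ∑[ a < m ] good a
    ∑⁴-cong : ∀ {f g} → (∀ a b c d → f a b c d ≡ g a b c d) → ∑⁴ f ≡ ∑⁴ g
    ∑⁴-cong eq = ∑-cong m λ a → ∑-cong m λ b → ∑-cong m λ c → ∑-cong m λ d → eq a b c d
    ∑⁴-distrib-+ : ∀ f g → ∑⁴ (λ a b c d → f a b c d + g a b c d) ≡ ∑⁴ f + ∑⁴ g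
    ∑⁴-distrib-+ f g = trans (∑-cong m λ a → trans (∑-cong m λ b → trans (∑-cong m λ c →
      ∑-distrib-+ m (f a b c) (g a b c)) (∑-distrib-+ m _ _)) (∑-distrib-+ m _ _)) (∑-distrib-+ m _ _)
    partition : ∀ x y u v h → x + y ≡ 1 → u + v ≡ 1 → h ≡ x * h + (y * u * h + y * v * h)
    partition x y u v h x+y≡1 u+v≡1 = begin
      h                          ≡⟨ *-identityˡ h ⟨
      1 * h                      ≡⟨ cong (_* h) (trans (cong (λ t → x + y * t) u+v≡1)
                                      (trans (cong (_+_ x) (*-identityʳ y)) x+y≡1)) ⟨
      (x + y * (u + v)) * h      ≡⟨ expand x y u v h ⟩
      x * h + (y * u * h + y * v * h) ∎
      where
      expand : ∀ x y u v h → (x + y * (u + v)) * h ≡ x * h + (y * u * h + y * v * h)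
      expand = ℕ-Solver.solve-∀
    split : ∀ a b c d → inC a b c d ≡ [ ℓ ∤ + c ] * inC a b c d
                         + ([ ℓ ∣ + c ] * [ ℓ ∤ + b ] * inC a b c d + [ ℓ ∣ + c ] * [ ℓ ∣ + b ] * inC a b c d)
    split a b c d = partition [ ℓ ∤ + c ] [ ℓ ∣ + c ] [ ℓ ∤ + b ] [ ℓ ∣ + b ] (inC a b c d)
      (𝟙-¬+𝟙 (ℓ ∣? c)) (𝟙-¬+𝟙 (ℓ ∣? b))

  ∑⁴-inC-closed-form :
    + ∑⁴ inC ≡ + (ℓ ^ (3 * e + 1)) *ᶻ ((+ (ℓ ^ 2) -ᶻ + ℓ -ᶻ + 1) -ᶻ legendreSq (+ N -ᶻ + 1) ℓ)
  ∑⁴-inC-closed-form = begin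
    + ∑⁴ inC
      ≡⟨ cong +_ ∑⁴-inC ⟩
    + (m * (φ * φ) + m * (p * (p * q)))
      ≡⟨ cast m φ p q ⟩
    + m *ᶻ (+ φ *ᶻ + φ) +ᶻ + m *ᶻ (+ p *ᶻ (+ p *ᶻ + q))
      ≡⟨ closed-form (+ ℓ) (+ p) (+ D) (ℤ.pos-* ℓ p) φ≡ℓp-p q≡ℓ+D-3 ⟩
    (+ p *ᶻ (+ p *ᶻ (+ p *ᶻ + ℓ))) *ᶻ ((+ ℓ *ᶻ + ℓ -ᶻ + ℓ -ᶻ + 1) -ᶻ (+ 1 -ᶻ + D))
      ≡⟨ cong₂ _*ᶻ_ ℓ^[3e+1] (cong₂ (λ x y → (x -ᶻ + ℓ -ᶻ + 1) -ᶻ y) ℓ² legendreSq≡1-D) ⟨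
    + (ℓ ^ (3 * e + 1)) *ᶻ ((+ (ℓ ^ 2) -ᶻ + ℓ -ᶻ + 1) -ᶻ legendreSq (+ N -ᶻ + 1) ℓ) ∎
    where
    open ≡-Reasoning
    q D : ℕ
    q = ∑[ a < ℓ ] good a
    D = [ ℓ ∣ + N -ᶻ + 1 ]
    cast : ∀ M F P Q → + (M * (F * F) + M * (P * (P * Q)))
                       ≡ + M *ᶻ (+ F *ᶻ + F) +ᶻ + M *ᶻ (+ P *ᶻ (+ P *ᶻ + Q))
    cast M F P Q = trans (ℤ.pos-+ (M * (F * F)) _) (cong₂ _+ᶻ_
      (trans (ℤ.pos-* M _) (cong (+ M *ᶻ_) (ℤ.pos-* F F)))
      (trans (ℤ.pos-* M _) (cong (+ M *ᶻ_) (trans (ℤ.pos-* P _) (cong (+ P *ᶻ_) (ℤ.pos-* P Q))))))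
    +-cancelʳ : ∀ {x y z} → x + y ≡ z → + x ≡ + z -ᶻ + y
    +-cancelʳ {x} {y} refl = trans (identity (+ x) (+ y)) (cong (_-ᶻ + y) (sym (ℤ.pos-+ x y)))
      where
      identity : ∀ x y → x ≡ (x +ᶻ y) -ᶻ y
      identity = solve-∀
    φ≡ℓp-p : + φ ≡ + ℓ *ᶻ + p -ᶻ + p
    φ≡ℓp-p = trans (+-cancelʳ φ+p≡m) (cong (_-ᶻ + p) (ℤ.pos-* ℓ p))
    q≡ℓ+D-3 : + q ≡ + ℓ +ᶻ + D -ᶻ + 3
    q≡ℓ+D-3 = trans (+-cancelʳ ∑a-good-mod-ℓ) (cong (_-ᶻ + 3) (ℤ.pos-+ ℓ D))
    closed-form : ∀ {M F Q} L P D → M ≡ L *ᶻ P → F ≡ L *ᶻ P -ᶻ P → Q ≡ L +ᶻ D -ᶻ + 3 →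
      M *ᶻ (F *ᶻ F) +ᶻ M *ᶻ (P *ᶻ (P *ᶻ Q))
      ≡ (P *ᶻ (P *ᶻ (P *ᶻ L))) *ᶻ ((L *ᶻ L -ᶻ L -ᶻ + 1) -ᶻ (+ 1 -ᶻ D))
    closed-form L P D refl refl refl = identity L P D
      where
      identity : ∀ L P D →
        (L *ᶻ P) *ᶻ ((L *ᶻ P -ᶻ P) *ᶻ (L *ᶻ P -ᶻ P)) +ᶻ (L *ᶻ P) *ᶻ (P *ᶻ (P *ᶻ (L +ᶻ D -ᶻ + 3)))
        ≡ (P *ᶻ (P *ᶻ (P *ᶻ L))) *ᶻ ((L *ᶻ L -ᶻ L -ᶻ + 1) -ᶻ (+ 1 -ᶻ D))
      identity = solve-∀
    ℓ^[3e+1] : + (ℓ ^ (3 * e + 1)) ≡ + p *ᶻ (+ p *ᶻ (+ p *ᶻ + ℓ))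
    ℓ^[3e+1] = trans (cong +_ (begin
      ℓ ^ (e + (e + (e + 0)) + 1)          ≡⟨ ^-distribˡ-+-* ℓ (e + (e + (e + 0))) 1 ⟩
      ℓ ^ (e + (e + (e + 0))) * ℓ ^ 1      ≡⟨ cong₂ _*_ (trans (^-distribˡ-+-* ℓ e _)
                                                (cong (p *_) (trans (^-distribˡ-+-* ℓ e _)
                                                  (cong (λ k → p * ℓ ^ k) (+-identityʳ e)))))
                                              (*-identityʳ ℓ) ⟩
      p * (p * p) * ℓ                      ≡⟨ trans (*-assoc p (p * p) ℓ) (cong (p *_) (*-assoc p p ℓ)) ⟩
      p * (p * (p * ℓ)) ∎))
      (trans (ℤ.pos-* p _) (cong (+ p *ᶻ_) (trans (ℤ.pos-* p _) (cong (+ p *ᶻ_) (ℤ.pos-* p ℓ)))))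
    ℓ² : + (ℓ ^ 2) ≡ + ℓ *ᶻ + ℓ
    ℓ² = trans (cong (λ t → + (ℓ * t)) (*-identityʳ ℓ)) (ℤ.pos-* ℓ ℓ)
    legendreSq≡1-D : legendreSq (+ N -ᶻ + 1) ℓ ≡ + 1 -ᶻ + D
    legendreSq≡1-D with ℓ ∣? ∣ + N -ᶻ + 1 ∣
    ... | yes _ = refl
    ... | no _  = refl

  inC-correct : ∀ n → ν ℓ n ≡ 0 → ∀ (x y z w : Fin m) →
    𝟙 (InC? N n ℓ (suc e) (x , y , z , w)) ≡ inC (toℕ x) (toℕ y) (toℕ z) (toℕ w)
  inC-correct n ν≡0 x y z w =
    trans (𝟙-cong (InC? N n ℓ (suc e) σ) (m∣Δ? ×-dec ℓ∤T?) to from) (𝟙-× m∣Δ? ℓ∤T?)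
    where
    σ = (x , y , z , w)
    a = toℕ x
    b = toℕ y
    c = toℕ z
    d = toℕ w
    m∣Δ? = m ∣? ∣ Δ a b c d ∣
    ℓ∤T? = ¬? (ℓ ∣? ∣ T a d ∣)
    ℓ∣det⇔ℓ∣T : m ∣ ∣ Δ a b c d ∣ →
      (+ ℓ ∣ᶻ det σ → + ℓ ∣ᶻ T a d) × (+ ℓ ∣ᶻ T a d → + ℓ ∣ᶻ det σ)
    ℓ∣det⇔ℓ∣T m∣Δ = ∣-diffʳ {x = det σ} ℓ∣det-T , ∣-diffˡ {x = det σ} ℓ∣det-T
      where
      ℓ∣det-T = m∣⇒ℓ∣ (subst (+ m ∣ᶻ_) (Δ≡det-T a b c d) (∣ᵤ⇒∣ m∣Δ))
    to : InC N n ℓ (suc e) σ → (m ∣ ∣ Δ a b c d ∣) × ¬ (ℓ ∣ ∣ T a d ∣)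
    to ((v , m∣det·v-1) , m∣Δ , _) = m∣Δ , λ ℓ∣T → prime∤1 ℓ-prime
      (∣-diffʳ {x = det σ *ᶻ ent v} (m∣⇒ℓ∣ (∣ᵤ⇒∣ m∣det·v-1))
        (∣m⇒∣m*n (ent v) (proj₂ (ℓ∣det⇔ℓ∣T m∣Δ) (∣ᵤ⇒∣ ℓ∣T))))
    from : (m ∣ ∣ Δ a b c d ∣) × ¬ (ℓ ∣ ∣ T a d ∣) → InC N n ℓ (suc e) σ
    from (m∣Δ , ℓ∤T) = reduce (invertible-mod-prime^ ℓ-prime {det σ} ℓ∤det (suc e)) , m∣Δ ,
      subst (λ k → CongI (ℓ ^ k) σ) (sym ν≡0) (1∣ _ , 1∣ _ , 1∣ _ , 1∣ _)
      where
      ℓ∤det : ¬ ℓ ∣ ∣ det σ ∣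
      ℓ∤det ℓ∣det = ℓ∤T (∣⇒∣ᵤ (proj₁ (ℓ∣det⇔ℓ∣T m∣Δ) (∣ᵤ⇒∣ ℓ∣det)))
      reduce : Invertible m (det σ) → InGL₂ m σ
      reduce (v , m∣det·v-1) = fromℕ< (n%ℕd<d v m) , ∣⇒∣ᵤ (subst (λ r → + m ∣ᶻ det σ *ᶻ + r -ᶻ + 1)
        (sym (toℕ-fromℕ< (n%ℕd<d v m)))
        (∣-lincomb (+ 1) (-ᶻ det σ) m∣det·v-1 (∣-%ℕ v m) (identity (det σ) v (+ (v %ℕ m)))))
        where
        identity : ∀ δ v r → δ *ᶻ r -ᶻ + 1 ≡ + 1 *ᶻ (δ *ᶻ v -ᶻ + 1) +ᶻ (-ᶻ δ) *ᶻ (v -ᶻ r)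
        identity = solve-∀

  #C≡∑⁴inC : ∀ n → ν ℓ n ≡ 0 → #C N n ℓ (suc e) ≡ ∑⁴ inC
  #C≡∑⁴inC n ν≡0 = trans (length-filter (InC? N n ℓ (suc e)) (allMat₂ m))
    (sum-allMat₂ m _ inC (inC-correct n ν≡0))

propositionA4 : (ℓ n N : ℕ) → Prime ℓ → n ≥ 1 → N ≥ 1 → (n ^ 2) ∣ N → ¬ (ℓ ∣ N) →
    (e : ℕ) → e ≥ 1 →
    + (#C N n ℓ e) ≡
      + (ℓ ^ (3 * (e ∸ 1) + 1)) *ᶻ ((+ (ℓ ^ 2) -ᶻ + ℓ -ᶻ + 1) -ᶻ legendreSq (+ N -ᶻ + 1) ℓ)
propositionA4 ℓ n N ℓ-prime _ _ n²∣N ℓ∤N (suc e) _ =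
  trans (cong +_ (#C≡∑⁴inC n (ν≡0 ℓ n ℓ∤n))) ∑⁴-inC-closed-form
  where
  open Count ℓ N e ℓ-prime ℓ∤N
  ℓ∤n : ¬ ℓ ∣ n
  ℓ∤n ℓ∣n = ℓ∤N (∣-trans (∣-trans ℓ∣n (m∣m*n (n * 1))) n²∣N)
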